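{- Let $G$ be a $(2,1)$-graph and let $G'$ be a Laman circuit in $G$. Then either $G'$ is contained in a $(2,2)$-circuit of $G$, or $G'$ is a fundamental Laman circuit with respect to any Laman basis of $G$.
   Context: For a subgraph, $n'$ is the number of vertices it spans, $m'$ its number of edges. A graph with $n$ vertices and $m$ edges is $(k,\ell)$-sparse if every non-empty subgraph has $m'\le kn'-\ell$, and a $(k,\ell)$-graph if moreover $m=kn-\ell$. A $(k,\ell)$-circuit is an edge-minimal graph that is not $(k,\ell)$-sparse. "Laman" means $(2,3)$. A Laman basis of $G$ is a maximal Laman-sparse subgraph (edge subset); for a Laman basis $L$ and an edge $e\notin L$, the fundamental Laman circuit of $e$ w.r.t. $L$ is the unique Laman circuit in $L+e$. -}

module Defs where

open import Data.Nat using (ℕ; zero; suc; _+_; _*_; _≤_)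
open import Data.Bool using (Bool; true; false; _∧_; _∨_)
open import Data.Fin using (Fin; zero; suc; _≟_)
open import Data.Fin.Subset using (Subset; _⊆_; _⊂_; _∪_; ⁅_⁆; _∈_; _∉_; ∣_∣; Nonempty)
open import Data.Vec using (lookup; tabulate)
open import Data.Product using (_×_; proj₁; proj₂; ∃; Σ; _,_)
open import Relation.Nullary using (¬_; does)
open import Relation.Binary.PropositionalEquality using (_≡_)

-- A (multi)graph on vertex set Fin n with m edges (parallel edges and
-- loops allowed); edge e has endpoints G e.
Graph : ℕ → ℕ → Set
Graph n m = Fin m → Fin n × Fin n

-- Subgraphs are edge subsets.
EdgeSet : ℕ → Set
EdgeSet m = Subset m

anyFin : (m : ℕ) → (Fin m → Bool) → Bool
anyFin zero    f = false
anyFin (suc m) f = f zero ∨ anyFin m (λ i → f (suc i))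

incident : ∀ {n m} → Graph n m → Fin m → Fin n → Bool
incident G e v = does (proj₁ (G e) ≟ v) ∨ does (proj₂ (G e) ≟ v)

span : ∀ {n m} → Graph n m → EdgeSet m → Subset n
span {n} {m} G S = tabulate λ v → anyFin m (λ e → lookup S e ∧ incident G e v)

-- n' = number of spanned vertices, m' = number of edges.
-- (k,ℓ)-sparse: every non-empty sub-edge-set T has m' ≤ k n' − ℓ,
-- written over ℕ as m' + ℓ ≤ k n'.
Sparse : ∀ {n m} → ℕ → ℕ → Graph n m → EdgeSet m → Set
Sparse k ℓ G S = ∀ T → T ⊆ S → Nonempty T → ∣ T ∣ + ℓ ≤ k * ∣ span G T ∣

IsKLGraph : ∀ {n m} → ℕ → ℕ → Graph n m → Set
IsKLGraph {n} {m} k ℓ G = Sparse k ℓ G Data.Fin.Subset.⊤ × m + ℓ ≡ k * n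

Circuit : ∀ {n m} → ℕ → ℕ → Graph n m → EdgeSet m → Set
Circuit k ℓ G C = ¬ Sparse k ℓ G C × (∀ T → T ⊂ C → Sparse k ℓ G T)

LamanSparse : ∀ {n m} → Graph n m → EdgeSet m → Set
LamanSparse = Sparse 2 3

LamanCircuit : ∀ {n m} → Graph n m → EdgeSet m → Set
LamanCircuit = Circuit 2 3

LamanBasis : ∀ {n m} → Graph n m → EdgeSet m → Set
LamanBasis G L = LamanSparse G L × (∀ e → e ∉ L → ¬ LamanSparse G (L ∪ ⁅ e ⁆))

FundamentalCircuitOf : ∀ {n m} → Graph n m → EdgeSet m → Fin m → EdgeSet m → Set
FundamentalCircuitOf G L e C = e ∉ L × LamanCircuit G C × C ⊆ (L ∪ ⁅ e ⁆)

IsFundamentalCircuit : ∀ {n m} → Graph n m → EdgeSet m → EdgeSet m → Set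
IsFundamentalCircuit G L C = ∃ λ e → FundamentalCircuitOf G L e C

module Submission where

-- For a Laman basis L we show that at most
-- one edge of G' lies outside L, so G' ⊆ L + e for the edge e ∈ G' ∖ L.
--
-- With c = #edges and s = #spanned
-- vertices, c is modular and s submodular on edge sets, so if U is tight
-- enough and meets G' in a proper non-empty part (which is Laman-sparse, G'
-- being a circuit), then U ∪ G' is tighter still by one (lemma glue).
-- Hence if L + f (f ∈ G' ∖ L) contained a Laman violation T while a second
-- edge e ∈ G' ∖ L exists, T ∪ G' would violate (2,2)-sparsity; a
-- (2,2)-circuit inside it must contain G' (otherwise gluing once more
-- violates the (2,1)-sparsity of G, or the circuit lies in L), contrary to
-- the assumption.  So L + f is Laman-sparse, contradicting maximality of L.

open import Defs
open import Data.Nat using (ℕ; suc; _+_; _*_; _≤_; _<_; _≤?_; s≤s)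
open import Data.Nat.Properties
open import Data.Nat.Tactic.RingSolver using (solve-∀)
open import Data.Bool using (Bool; true; false; _∧_)
open import Data.Bool.Properties using (∨-zeroʳ)
open import Data.Fin using (Fin; zero; suc) renaming (_≟_ to _≟F_)
open import Data.Fin.Subset using (Subset; _⊆_; _⊂_; _∈_; _∉_; _∪_; _∩_; ∣_∣; Nonempty; ⁅_⁆)
open import Data.Fin.Subset.Properties
open import Data.Fin.Properties using (any?)
open import Data.Vec using (_∷_; []; lookup)
open import Data.Vec.Properties using (lookup∘tabulate; []=⇒lookup; lookup⇒[]=)
open import Data.Product using (∃; _×_; _,_; proj₁; proj₂)
open import Data.Sum using (_⊎_; inj₁; inj₂)
open import Data.Empty using (⊥; ⊥-elim)
open import Function using (id)
open import Function.Bundles using (Equivalence)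
open import Relation.Nullary using (¬_; Dec; yes; no; ¬?; _×-dec_)
open import Relation.Nullary.Decidable using (decidable-stable)
open import Relation.Binary.PropositionalEquality

anyFin-intro : ∀ m (f : Fin m → Bool) i → f i ≡ true → anyFin m f ≡ true
anyFin-intro (suc m) f zero    fi rewrite fi = refl
anyFin-intro (suc m) f (suc i) fi
  rewrite anyFin-intro m (λ j → f (suc j)) i fi = ∨-zeroʳ (f zero)

anyFin-elim : ∀ m (f : Fin m → Bool) → anyFin m f ≡ true → ∃ λ i → f i ≡ true
anyFin-elim (suc m) f found with f zero in f0
... | true  = zero , f0
... | false with anyFin-elim m (λ j → f (suc j)) found
...   | i , fi = suc i , fi

∧-intro : ∀ {a b} → a ≡ true → b ≡ true → (a ∧ b) ≡ true
∧-intro refl refl = refl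

∧-elim : ∀ a b → (a ∧ b) ≡ true → a ≡ true × b ≡ true
∧-elim true true refl = refl , refl

⊈-witness : ∀ {k} {p q : Subset k} → ¬ (p ⊆ q) → ∃ λ x → x ∈ p × x ∉ q
⊈-witness {p = p} {q} p⊈q =
  decidable-stable (any? λ x → (x ∈? p) ×-dec ¬? (x ∈? q)) λ none →
    p⊈q λ {x} x∈p → decidable-stable (x ∈? q) λ x∉q → none (x , x∈p , x∉q)

∣p∪q∣+∣p∩q∣ : ∀ {k} (p q : Subset k) → ∣ p ∪ q ∣ + ∣ p ∩ q ∣ ≡ ∣ p ∣ + ∣ q ∣
∣p∪q∣+∣p∩q∣ []          []          = refl
∣p∪q∣+∣p∩q∣ (true ∷ p)  (true ∷ q)  =
  cong suc (trans (+-suc _ _) (trans (cong suc (∣p∪q∣+∣p∩q∣ p q)) (sym (+-suc _ _))))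
∣p∪q∣+∣p∩q∣ (true ∷ p)  (false ∷ q) = cong suc (∣p∪q∣+∣p∩q∣ p q)
∣p∪q∣+∣p∩q∣ (false ∷ p) (true ∷ q)  = trans (cong suc (∣p∪q∣+∣p∩q∣ p q)) (sym (+-suc _ _))
∣p∪q∣+∣p∩q∣ (false ∷ p) (false ∷ q) = ∣p∪q∣+∣p∩q∣ p q

∈-∪⁅⁆⁻ : ∀ {k} {p : Subset k} {x y} → x ∈ p ∪ ⁅ y ⁆ → x ∈ p ⊎ x ≡ y
∈-∪⁅⁆⁻ {p = p} {y = y} x∈ with x∈p∪q⁻ p ⁅ y ⁆ x∈
... | inj₁ x∈p = inj₁ x∈p
... | inj₂ x∈y = inj₂ (Equivalence.to x∈⁅y⁆⇔x≡y x∈y)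

module _ {n m : ℕ} (G : Graph n m) where

  span-intro : ∀ {S : EdgeSet m} {e v} → e ∈ S → incident G e v ≡ true → v ∈ span G S
  span-intro {S} {e} {v} e∈S inc = lookup⇒[]= v _
    (trans (lookup∘tabulate _ v) (anyFin-intro m _ e (∧-intro ([]=⇒lookup e∈S) inc)))

  span-elim : ∀ {S : EdgeSet m} {v} → v ∈ span G S → ∃ λ e → e ∈ S × incident G e v ≡ true
  span-elim {S} {v} v∈ with anyFin-elim m _ (trans (sym (lookup∘tabulate _ v)) ([]=⇒lookup v∈))
  ... | e , found with ∧-elim (lookup S e) _ found
  ...   | e∈S , inc = e , lookup⇒[]= e S e∈S , inc

  span-mono : ∀ {S T : EdgeSet m} → S ⊆ T → span G S ⊆ span G T
  span-mono S⊆T v∈ with span-elim v∈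
  ... | e , e∈S , inc = span-intro (S⊆T e∈S) inc

  span-∪ : ∀ A B → span G (A ∪ B) ⊆ span G A ∪ span G B
  span-∪ A B v∈ with span-elim v∈
  ... | e , e∈ , inc with x∈p∪q⁻ A B e∈
  ...   | inj₁ e∈A = x∈p∪q⁺ (inj₁ (span-intro e∈A inc))
  ...   | inj₂ e∈B = x∈p∪q⁺ (inj₂ (span-intro e∈B inc))

  span-∩ : ∀ A B → span G (A ∩ B) ⊆ span G A ∩ span G B
  span-∩ A B v∈ = x∈p∩q⁺ (span-mono (p∩q⊆p A B) v∈ , span-mono (p∩q⊆q A B) v∈)

  span-submodular : ∀ A B →
    ∣ span G (A ∪ B) ∣ + ∣ span G (A ∩ B) ∣ ≤ ∣ span G A ∣ + ∣ span G B ∣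
  span-submodular A B = begin
    ∣ span G (A ∪ B) ∣ + ∣ span G (A ∩ B) ∣
      ≤⟨ +-mono-≤ (p⊆q⇒∣p∣≤∣q∣ (span-∪ A B)) (p⊆q⇒∣p∣≤∣q∣ (span-∩ A B)) ⟩
    ∣ span G A ∪ span G B ∣ + ∣ span G A ∩ span G B ∣
      ≡⟨ ∣p∪q∣+∣p∩q∣ (span G A) (span G B) ⟩
    ∣ span G A ∣ + ∣ span G B ∣ ∎
    where open ≤-Reasoning

module _ {n m : ℕ} (k l : ℕ) (G : Graph n m) where

  sparse-contra : ∀ {S T} → Sparse k l G S → T ⊆ S → Nonempty T →
    k * ∣ span G T ∣ < ∣ T ∣ + l → ⊥
  sparse-contra sp T⊆S neT viol = <-irrefl refl (<-≤-trans viol (sp _ T⊆S neT))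

  sparse-mono : ∀ {S S'} → S ⊆ S' → Sparse k l G S' → Sparse k l G S
  sparse-mono S⊆S' sp T T⊆S = sp T (⊆-trans T⊆S S⊆S')

  decSparse : ∀ S → Dec (Sparse k l G S)
  decSparse S with anySubset? (λ T →
    (T ⊆? S) ×-dec (nonempty? T ×-dec ¬? (∣ T ∣ + l ≤? k * ∣ span G T ∣)))
  ... | yes (T , T⊆S , neT , bad) = no λ sp → bad (sp T T⊆S neT)
  ... | no none = yes λ T T⊆S neT →
    decidable-stable (_ ≤? _) λ bad → none (T , T⊆S , neT , bad)

  decCircuit : ∀ C → Dec (Circuit k l G C)
  decCircuit C = ¬? (decSparse C) ×-dec properSparse?
    where
    properSparse? : Dec (∀ T → T ⊂ C → Sparse k l G T)
    properSparse? with anySubset? (λ T → (T ⊂? C) ×-dec ¬? (decSparse T))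
    ... | yes (T , T⊂C , nsT) = no λ h → nsT (h T T⊂C)
    ... | no none = yes λ T T⊂C → decidable-stable (decSparse T) λ nsT → none (T , T⊂C , nsT)

  circuit-within : ∀ S → ¬ Sparse k l G S → ∃ λ C → Circuit k l G C × C ⊆ S
  circuit-within S = descend (suc ∣ S ∣) S ≤-refl
    where
    descend : ∀ b S → ∣ S ∣ < b → ¬ Sparse k l G S → ∃ λ C → Circuit k l G C × C ⊆ S
    descend (suc b) S small nsS with anySubset? (λ T → (T ⊂? S) ×-dec ¬? (decSparse T))
    ... | yes (T , T⊂S , nsT) with descend b T (≤-trans (p⊂q⇒∣p∣<∣q∣ T⊂S) (≤-pred small)) nsT
    ...   | C , circuit , C⊆T = C , circuit , ⊆-trans C⊆T (proj₁ T⊂S)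
    descend (suc b) S small nsS | no none =
      S , (nsS , λ T T⊂S → decidable-stable (decSparse T) λ nsT → none (T , T⊂S , nsT)) , id

  circuit-proper : ∀ {C T} → Circuit k l G C → T ⊆ C → ¬ (C ⊆ T) → Nonempty T →
    ∣ T ∣ + l ≤ k * ∣ span G T ∣
  circuit-proper (_ , properSparse) T⊆C C⊈T neT with ⊈-witness C⊈T
  ... | x , x∈C , x∉T = properSparse _ (T⊆C , x , x∈C , x∉T) _ id neT

  circuit-violates : ∀ {C} → Circuit k l G C → Nonempty C × k * ∣ span G C ∣ < ∣ C ∣ + l
  circuit-violates {C} circuit@(nsC , _) with nonempty? C
  ... | no emptyC = ⊥-elim (nsC λ T T⊆C (x , x∈T) → ⊥-elim (emptyC (x , T⊆C x∈T)))
  ... | yes neC = neC , ≰⇒> λ countC → nsC λ T T⊆C neT → countOf T T⊆C neT countC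
    where
    countOf : ∀ T → T ⊆ C → Nonempty T → ∣ C ∣ + l ≤ k * ∣ span G C ∣ →
      ∣ T ∣ + l ≤ k * ∣ span G T ∣
    countOf T T⊆C neT countC with C ⊆? T
    ... | yes C⊆T rewrite ⊆-antisym T⊆C C⊆T = countC
    ... | no C⊈T = circuit-proper circuit T⊆C C⊈T neT

-- The count behind gluing, with c = #edges, s = #vertices: if A violates
-- 2s ≥ c + 2 + b, B violates Laman sparsity, the intersection I satisfies
-- it, c is modular and s submodular on A, B, U = A ∪ B, I = A ∩ B, then U
-- violates 2s ≥ c + 1 + b.
unionCount : ∀ {cA cB cU cI sA sB sU sI} b →
  2 * sA < cA + (2 + b) → 2 * sB < cB + 3 → cI + 3 ≤ 2 * sI →
  cU + cI ≡ cA + cB → sU + sI ≤ sA + sB → 2 * sU < cU + (1 + b)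
unionCount {cA} {cB} {cU} {cI} {sA} {sB} {sU} {sI} b tightA tightB sparseI cardU spanU =
  ≤-trans (s≤s (+-cancelʳ-≤ (cI + 5) (2 * sU) (cU + b) cancelled)) (≤-reflexive (sym (+-suc cU b)))
  where
  regroup₁ : ∀ x y → x + (y + 5) ≡ x + (y + 3) + 2
  regroup₁ = solve-∀
  regroup₂ : ∀ x y → 2 * (x + y) + 2 ≡ suc (2 * x) + suc (2 * y)
  regroup₂ = solve-∀
  regroup₃ : ∀ a c z → a + (2 + z) + (c + 3) ≡ a + c + (z + 5)
  regroup₃ = solve-∀
  regroup₄ : ∀ u i z → u + i + (z + 5) ≡ u + z + (i + 5)
  regroup₄ = solve-∀
  open ≤-Reasoning
  cancelled : 2 * sU + (cI + 5) ≤ cU + b + (cI + 5)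
  cancelled = begin
    2 * sU + (cI + 5)         ≡⟨ regroup₁ (2 * sU) cI ⟩
    2 * sU + (cI + 3) + 2     ≤⟨ +-monoˡ-≤ 2 (+-monoʳ-≤ (2 * sU) sparseI) ⟩
    2 * sU + 2 * sI + 2       ≡⟨ cong (_+ 2) (sym (*-distribˡ-+ 2 sU sI)) ⟩
    2 * (sU + sI) + 2         ≤⟨ +-monoˡ-≤ 2 (*-monoʳ-≤ 2 spanU) ⟩
    2 * (sA + sB) + 2         ≡⟨ regroup₂ sA sB ⟩
    suc (2 * sA) + suc (2 * sB) ≤⟨ +-mono-≤ tightA tightB ⟩
    cA + (2 + b) + (cB + 3)   ≡⟨ regroup₃ cA cB b ⟩
    cA + cB + (b + 5)         ≡⟨ cong (_+ (b + 5)) (sym cardU) ⟩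
    cU + cI + (b + 5)         ≡⟨ regroup₄ cU cI b ⟩
    cU + b + (cI + 5)         ∎

module LamanCircuitIn {n m} (G : Graph n m) (isGraph21 : IsKLGraph 2 1 G)
                      (G' : EdgeSet m) (circuitG' : LamanCircuit G G') where

  InTwoTwoCircuit : Set
  InTwoTwoCircuit = ∃ λ C → Circuit 2 2 G C × G' ⊆ C

  decInTwoTwoCircuit : Dec InTwoTwoCircuit
  decInTwoTwoCircuit = anySubset? λ C → decCircuit 2 2 G C ×-dec (G' ⊆? C)

  glue : ∀ {U} b → 2 * ∣ span G U ∣ < ∣ U ∣ + (2 + b) → Nonempty (U ∩ G') → ¬ (G' ⊆ U) →
    2 * ∣ span G (U ∪ G') ∣ < ∣ U ∪ G' ∣ + (1 + b)
  glue {U} b tightU meets G'⊈U =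
    unionCount {sA = ∣ span G U ∣} {∣ span G G' ∣} {∣ span G (U ∪ G') ∣} {∣ span G (U ∩ G') ∣}
      b tightU (proj₂ (circuit-violates 2 3 G circuitG'))
      (circuit-proper 2 3 G circuitG' (p∩q⊆q U G') G'⊈U∩G' meets)
      (∣p∪q∣+∣p∩q∣ U G') (span-submodular G U G')
    where
    G'⊈U∩G' : ¬ (G' ⊆ U ∩ G')
    G'⊈U∩G' G'⊆U∩G' = G'⊈U (⊆-trans G'⊆U∩G' (p∩q⊆p U G'))

  -- Relative to a Laman-sparse L, every (2,2)-circuit inside L ∪ G'
  -- contains G': otherwise it meets G' properly and gluing violates the
  -- (2,1)-sparsity of G, or it misses G' and so lies in L.
  twoTwoCircuit-contains : ∀ {L C} → LamanSparse G L → Circuit 2 2 G C → C ⊆ L ∪ G' → G' ⊆ C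
  twoTwoCircuit-contains {L} {C} sparseL circuitC C⊆L∪G' =
    decidable-stable (G' ⊆? C) λ G'⊈C → case-meets G'⊈C (nonempty? (C ∩ G'))
    where
    neC : Nonempty C
    neC = proj₁ (circuit-violates 2 2 G circuitC)
    tightC : 2 * ∣ span G C ∣ < ∣ C ∣ + 2
    tightC = proj₂ (circuit-violates 2 2 G circuitC)
    case-meets : ¬ (G' ⊆ C) → Dec (Nonempty (C ∩ G')) → ⊥
    case-meets G'⊈C (yes meets) =
      sparse-contra 2 1 G (proj₁ isGraph21) (λ _ → ∈⊤) (proj₁ neC , p⊆p∪q G' (proj₂ neC))
        (glue 0 tightC meets G'⊈C)
    case-meets G'⊈C (no disjoint) =
      sparse-contra 2 3 G sparseL C⊆L neC (≤-trans tightC (+-monoʳ-≤ ∣ C ∣ (n≤1+n 2)))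
      where
      C⊆L : C ⊆ L
      C⊆L {y} y∈C with x∈p∪q⁻ L G' (C⊆L∪G' y∈C)
      ... | inj₁ y∈L  = y∈L
      ... | inj₂ y∈G' = ⊥-elim (disjoint (y , x∈p∩q⁺ (y∈C , y∈G')))

  extend-sparse : ¬ InTwoTwoCircuit → ∀ {L e f} → LamanSparse G L →
    e ∈ G' → e ∉ L → f ∈ G' → e ≢ f → LamanSparse G (L ∪ ⁅ f ⁆)
  extend-sparse noCircuit {L} {e} {f} sparseL e∈G' e∉L f∈G' e≢f T T⊆L+f neT =
    decidable-stable (_ ≤? _) λ bad → case-f (≰⇒> bad) (f ∈? T)
    where
    case-f : 2 * ∣ span G T ∣ < ∣ T ∣ + 3 → Dec (f ∈ T) → ⊥
    case-f violT (no f∉T) = sparse-contra 2 3 G sparseL T⊆L neT violT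
      where
      T⊆L : T ⊆ L
      T⊆L y∈T with ∈-∪⁅⁆⁻ (T⊆L+f y∈T)
      ... | inj₁ y∈L = y∈L
      ... | inj₂ refl = ⊥-elim (f∉T y∈T)
    case-f violT (yes f∈T) = absorb (circuit-within 2 2 G (T ∪ G') notSparse22)
      where
      e∉T : e ∉ T
      e∉T e∈T with ∈-∪⁅⁆⁻ (T⊆L+f e∈T)
      ... | inj₁ e∈L = e∉L e∈L
      ... | inj₂ e≡f = e≢f e≡f
      notSparse22 : ¬ Sparse 2 2 G (T ∪ G')
      notSparse22 sp = sparse-contra 2 2 G sp id (f , p⊆p∪q G' f∈T)
        (glue 1 violT (f , x∈p∩q⁺ (f∈T , f∈G')) (λ G'⊆T → e∉T (G'⊆T e∈G')))
      T∪G'⊆L∪G' : T ∪ G' ⊆ L ∪ G'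
      T∪G'⊆L∪G' y∈ with x∈p∪q⁻ T G' y∈
      ... | inj₂ y∈G' = x∈p∪q⁺ (inj₂ y∈G')
      ... | inj₁ y∈T with ∈-∪⁅⁆⁻ (T⊆L+f y∈T)
      ...   | inj₁ y∈L = x∈p∪q⁺ (inj₁ y∈L)
      ...   | inj₂ refl = x∈p∪q⁺ (inj₂ f∈G')
      absorb : (∃ λ C → Circuit 2 2 G C × C ⊆ T ∪ G') → ⊥
      absorb (C , circuitC , C⊆T∪G') = noCircuit
        (C , circuitC , twoTwoCircuit-contains sparseL circuitC (⊆-trans C⊆T∪G' T∪G'⊆L∪G'))

  fundamental : ¬ InTwoTwoCircuit → ∀ L → LamanBasis G L → IsFundamentalCircuit G L G'
  fundamental noCircuit L (sparseL , maximalL)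
    with ⊈-witness (λ G'⊆L → proj₁ circuitG' (sparse-mono 2 3 G G'⊆L sparseL))
  ... | e , e∈G' , e∉L = e , e∉L , circuitG' , G'⊆L+e
    where
    G'⊆L+e : G' ⊆ L ∪ ⁅ e ⁆
    G'⊆L+e {x} x∈G' with x ∈? L | x ≟F e
    ... | yes x∈L | _      = x∈p∪q⁺ (inj₁ x∈L)
    ... | no _    | yes refl = x∈p∪q⁺ (inj₂ (x∈⁅x⁆ x))
    ... | no x∉L  | no x≢e = ⊥-elim (maximalL x x∉L
            (extend-sparse noCircuit sparseL e∈G' e∉L x∈G' (λ e≡x → x≢e (sym e≡x))))

mainTheorem10 : ∀ {n m} (G : Graph n m) → IsKLGraph 2 1 G →
    ∀ (G' : EdgeSet m) → LamanCircuit G G' →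
    (∃ λ C → Circuit 2 2 G C × G' ⊆ C)
    ⊎ (∀ L → LamanBasis G L → IsFundamentalCircuit G L G')
mainTheorem10 G isGraph21 G' circuitG' = decide decInTwoTwoCircuit
  where
  open LamanCircuitIn G isGraph21 G' circuitG'
  decide : Dec InTwoTwoCircuit → InTwoTwoCircuit ⊎ (∀ L → LamanBasis G L → IsFundamentalCircuit G L G')
  decide (yes inCircuit) = inj₁ inCircuit
  decide (no noCircuit)  = inj₂ (fundamental noCircuit)
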